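{- Let $p$ be a prime, $l\in\mathbb{N}$, and let $x\in\mathbb{R}$ with $x\notin\mathbb{Q}\setminus\mathcal{X}_{p^l}$. Let $y_i$ denote the $i$-th fin of an $\mathcal{F}_{p^l}$-continued fraction expansion of $x$ with maximum $+1$. If $y_i=\pm\frac12$ for some $i\ge1$, then $x\in\mathcal{X}_{p^l}$.
   Context: $\mathcal{X}_{p^l}=\{x/y: x,y\in\mathbb{Z},\ y>0,\ \gcd(x,y)=1,\ p^l\mid y\}\cup\{\infty\}$. An $\mathcal{F}_{p^l}$-continued fraction is a finite expression $\frac{1}{0+}\,\frac{p^l}{b+}\,\frac{\epsilon_1}{a_1+}\cdots\frac{\epsilon_n}{a_n}$ ($n\ge0$) or an infinite expression $\frac{1}{0+}\,\frac{p^l}{b+}\,\frac{\epsilon_1}{a_1+}\,\frac{\epsilon_2}{a_2+}\cdots$, where $b\in\mathbb{Z}$ is coprime to $p$, $a_i\in\mathbb{N}$, $\epsilon_i\in\{1,-1\}$, and for all relevant $i\ge1$: $a_i+\epsilon_{i+1}\ge1$, $a_i+\epsilon_i\ge1$, $\gcd(p_i,q_i)=1$ where $p_i=a_ip_{i-1}+\epsilon_ip_{i-2}$, $q_i=a_iq_{i-1}+\epsilon_iq_{i-2}$, $(p_{ -1},q_{ -1})=(1,0)$, $(p_0,q_0)=(b,p^l)$. The $p_i/q_i$ ($i\ge0$) are its convergents; the value is the last convergent or the limit of the convergents; an expansion of $x$ is one with value $x$. For $i\ge1$ the $i$-th fin is the value $y_i$ of the tail $\frac{\epsilon_i}{a_i+}\,\frac{\epsilon_{i+1}}{a_{i+1}+}\cdots$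 (so $y_i=\epsilon_i/(a_i+y_{i+1})$). A finite expansion of $z\in\mathcal{X}_{p^l}$ whose last pair $(\epsilon_n,a_n)\ne(1,1)$ is with maximum $+1$ if, among all $\mathcal{F}_{p^l}$-continued fraction expansions of $z$ not ending with $\frac11$, it has the largest number of indices $i\ge2$ with $\epsilon_i=+1$. An infinite one is with maximum $+1$ if for each $i\ge1$ with $(\epsilon_i,a_i)\ne(1,1)$ its truncation ending at $\frac{\epsilon_i}{a_i}$ is with maximum $+1$ as an expansion of $p_i/q_i$. -}

module Defs where

open import Data.Nat as ℕ using (ℕ; zero; suc; _^_; _≤_; _<_)
open import Data.Nat.Divisibility using (_∣_)
open import Data.Nat.Coprimality using (Coprime)
open import Data.Integer as ℤ using (ℤ; +_; -[1+_]; ∣_∣)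
open import Data.Rational using (ℚ)
open import Data.Product using (Σ; ∃; _×_; _,_; proj₁; proj₂)
open import Relation.Binary.PropositionalEquality using (_≡_)
open import Relation.Nullary using (¬_)

data Sgn : Set where
  pos neg : Sgn

sgn : Sgn → ℤ
sgn pos = + 1
sgn neg = -[1+ 0 ]

-- The digits of an F_{p^l}-continued fraction
--   1/(0+) p^l/(b+) ε₁/(a₁+) ε₂/(a₂+) ...
-- eps i = ε_i and a i = a_i for i ≥ 1 (the values at index 0 are unused).
-- A finite expansion of length n uses only the indices 1..n.

record Digits : Set where
  field
    b   : ℤ
    eps : ℕ → Sgn
    a   : ℕ → ℕ
open Digits public

-- state i = ((p_{i-1}, q_{i-1}) , (p_i , q_i)), with modulus m = p^l
state : ℕ → Digits → ℕ → (ℤ × ℤ) × (ℤ × ℤ)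
state m d zero = ((+ 1 , + 0) , (b d , + m))
state m d (suc i) with state m d i
... | ((p' , q') , (p₀ , q₀)) =
  ((p₀ , q₀) , ((+ a d (suc i)) ℤ.* p₀ ℤ.+ sgn (eps d (suc i)) ℤ.* p'
              , (+ a d (suc i)) ℤ.* q₀ ℤ.+ sgn (eps d (suc i)) ℤ.* q'))

conv : ℕ → Digits → ℕ → ℤ × ℤ
conv m d i = proj₂ (state m d i)

P Q : ℕ → Digits → ℕ → ℤ
P m d i = proj₁ (conv m d i)
Q m d i = proj₂ (conv m d i)

-- Finite tails: tail d i k = (N , D) with N/D equal to
--   ε_i/(a_i+) ε_{i+1}/(a_{i+1}+) ... ε_{i+k}/a_{i+k}
tail : Digits → ℕ → ℕ → ℤ × ℤ
tail d i zero = (sgn (eps d i) , + a d i)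
tail d i (suc k) with tail d (suc i) k
... | (N , D) = (sgn (eps d i) ℤ.* D , (+ a d i) ℤ.* D ℤ.+ N)

IndexOK : ℕ → Digits → ℕ → Set
IndexOK m d i =
  (1 ≤ a d i) ×
  (ℤ.+ 1 ℤ.≤ (+ a d i) ℤ.+ sgn (eps d i)) ×
  Coprime ∣ P m d i ∣ ∣ Q m d i ∣

NextOK : Digits → ℕ → Set
NextOK d i = ℤ.+ 1 ℤ.≤ (+ a d i) ℤ.+ sgn (eps d (suc i))

ValidFin : (p l : ℕ) → Digits → ℕ → Set
ValidFin p l d n =
  Coprime ∣ b d ∣ p ×
  (∀ i → 1 ≤ i → i ≤ n → IndexOK (p ^ l) d i) ×
  (∀ i → 1 ≤ i → i < n → NextOK d i)

ValidInf : (p l : ℕ) → Digits → Set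
ValidInf p l d =
  Coprime ∣ b d ∣ p ×
  (∀ i → 1 ≤ i → IndexOK (p ^ l) d i) ×
  (∀ i → 1 ≤ i → NextOK d i)

EndsWithOne : Digits → ℕ → Set
EndsWithOne d n = (1 ≤ n) × (eps d n ≡ pos) × (a d n ≡ 1)

ind : Sgn → ℕ
ind pos = 1
ind neg = 0

countPlus : Digits → ℕ → ℕ
countPlus d zero = 0
countPlus d (suc zero) = 0
countPlus d (suc (suc k)) = countPlus d (suc k) ℕ.+ ind (eps d (suc (suc k)))

-- the two finite expansions (d of length n, d' of length n') have the
-- same value p_n/q_n = p'_{n'}/q'_{n'} (in ℚ ∪ {∞})
SameValue : ℕ → Digits → ℕ → Digits → ℕ → Set
SameValue m d n d' n' = P m d n ℤ.* Q m d' n' ≡ P m d' n' ℤ.* Q m d n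

MaxPlusFin : (p l : ℕ) → Digits → ℕ → Set
MaxPlusFin p l d n =
  ValidFin p l d n × ¬ EndsWithOne d n ×
  (∀ (d' : Digits) (n' : ℕ) → ValidFin p l d' n' → ¬ EndsWithOne d' n' →
     SameValue (p ^ l) d n d' n' → countPlus d' n' ≤ countPlus d n)

MaxPlusInf : (p l : ℕ) → Digits → Set
MaxPlusInf p l d =
  ValidInf p l d ×
  (∀ i → 1 ≤ i → ¬ ((eps d i ≡ pos) × (a d i ≡ 1)) → MaxPlusFin p l d i)

-- the sequence of fractions f k = N_k/D_k tends to u/v (v > 0):
-- ∀ ε = 1/(c+1) ∃ K ∀ k ≥ K, |N_k/D_k - u/v| < ε  (and D_k ≠ 0)
TendsTo : (ℕ → ℤ × ℤ) → ℤ → ℕ → Set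
TendsTo f u v = ∀ c → ∃ λ K → ∀ k → K ≤ k →
  suc c ℕ.* ∣ proj₁ (f k) ℤ.* (+ v) ℤ.- u ℤ.* proj₂ (f k) ∣
    < ∣ proj₂ (f k) ∣ ℕ.* v

Cauchy : (ℕ → ℤ × ℤ) → Set
Cauchy f = ∀ c → ∃ λ K → ∀ j k → K ≤ j → K ≤ k →
  suc c ℕ.* ∣ proj₁ (f j) ℤ.* proj₂ (f k) ℤ.- proj₁ (f k) ℤ.* proj₂ (f j) ∣
    < ∣ proj₂ (f j) ∣ ℕ.* ∣ proj₂ (f k) ∣

TendsToℚ : (ℕ → ℤ × ℤ) → ℚ → Set
TendsToℚ f r = TendsTo f (ℚ.numerator r) (ℚ.denominatorℕ r)

EqualsℚF : ℤ × ℤ → ℚ → Set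
EqualsℚF (N , D) r = N ℤ.* ℚ.denominator r ≡ ℚ.numerator r ℤ.* D

-- X_{p^l} ∩ ℚ : rationals whose reduced denominator is divisible by p^l
InX : (p l : ℕ) → ℚ → Set
InX p l r = p ^ l ∣ ℚ.denominatorℕ r

data Half : ℤ → Set where
  half+ : Half (+ 1)
  half- : Half -[1+ 0 ]

-- If the i-th fin equals s/2 with s = ±1, substituting s/2 for the tail gives
--   x = (2 p_{i-1} + s p_{i-2}) / (2 q_{i-1} + s q_{i-2}),
-- because the map N/D ↦ (p_{i-1} D + p_{i-2} N)/(q_{i-1} D + q_{i-2} N) is continuous
-- wherever its denominator does not vanish. That denominator is exactly the one a
-- digit 2 with sign s would produce, and the digit conditions make the denominators
-- q_0 ≤ q_1 ≤ ... positive and increasing, so it is positive and x is rational; the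
-- hypothesis x ∉ ℚ ∖ X_{p^l} then gives x ∈ X_{p^l}. A finite expansion has the
-- rational value p_n/q_n outright.
module Submission where

open import Defs
open import Data.Nat as ℕ using (ℕ; zero; suc; z≤n; s≤s; _≤_; _∸_; _^_)
import Data.Nat.Properties as ℕP
import Data.Nat.Tactic.RingSolver as ℕRing
open import Data.Nat.Primality using (Prime; prime⇒nonZero)
open import Data.Integer as ℤ using (ℤ; +_; -[1+_]; ∣_∣; _+_; _-_; -_; _*_)
import Data.Integer.Properties as ℤP
import Data.Integer.Tactic.RingSolver as ℤRing
open import Data.Integer.GCD using (gcd)
open import Data.Rational as ℚ using (ℚ; ↥_; ↧_)
import Data.Rational.Properties as ℚP
open import Data.Product using (∃; ∃₂; _×_; _,_; proj₁; proj₂)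
open import Data.Empty using (⊥-elim)
open import Relation.Binary.PropositionalEquality
  using (_≡_; _≢_; refl; sym; trans; cong; cong₂; subst; module ≡-Reasoning)

/-cross-≡ : ∀ i n .{{_ : ℕ.NonZero n}} → i * ↧ (i ℚ./ n) ≡ ↥ (i ℚ./ n) * + n
/-cross-≡ i n = begin
  i * ↧ r           ≡⟨ cong (_* ↧ r) (sym (ℚP.↥-/ i n)) ⟩
  ↥ r * g * ↧ r     ≡⟨ ℤP.*-assoc (↥ r) g (↧ r) ⟩
  ↥ r * (g * ↧ r)   ≡⟨ cong (↥ r *_) (ℤP.*-comm g (↧ r)) ⟩
  ↥ r * (↧ r * g)   ≡⟨ cong (↥ r *_) (ℚP.↧-/ i n) ⟩
  ↥ r * + n         ∎
  where open ≡-Reasoning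
        r = i ℚ./ n
        g = gcd i (+ n)

fraction-toℚ : ∀ N D → D ≢ + 0 → ∃ λ r → EqualsℚF (N , D) r
fraction-toℚ N (+ zero)  D≢0 = ⊥-elim (D≢0 refl)
fraction-toℚ N (+ suc k) _   = N ℚ./ suc k , /-cross-≡ N (suc k)
fraction-toℚ N -[1+ k ]  _   = r , (begin
  N * ↧ r           ≡⟨ cong (_* ↧ r) (sym (ℤP.neg-involutive N)) ⟩
  - (- N) * ↧ r     ≡⟨ sym (ℤP.neg-distribˡ-* (- N) (↧ r)) ⟩
  - (- N * ↧ r)     ≡⟨ cong -_ (/-cross-≡ (- N) (suc k)) ⟩
  - (↥ r * + suc k) ≡⟨ ℤP.neg-distribʳ-* (↥ r) (+ suc k) ⟩
  ↥ r * -[1+ k ]    ∎)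
  where open ≡-Reasoning
        r = - N ℚ./ suc k

-- A pair ((p' , q') , (p , q)) of consecutive convergents acts by
-- N/D ↦ (p D + p' N)/(q D + q' N), substituting N/D for the rest of the expansion.
ConvergentPair : Set
ConvergentPair = (ℤ × ℤ) × (ℤ × ℤ)

_⊙_ : ConvergentPair → ℤ × ℤ → ℤ × ℤ
((p' , q') , (p , q)) ⊙ (N , D) = (p * D + p' * N , q * D + q' * N)

push : ℤ → ℤ → ConvergentPair → ConvergentPair
push a ε ((p' , q') , (p , q)) = ((p , q) , (a * p + ε * p' , a * q + ε * q'))

push-⊙ : ∀ a ε M → proj₂ (push a ε M) ≡ M ⊙ (ε , a)
push-⊙ a ε ((p' , q') , (p , q)) = cong₂ _,_ (swap a ε p p') (swap a ε q q')
  where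
  swap : ∀ a ε x x' → a * x + ε * x' ≡ x * a + x' * ε
  swap = ℤRing.solve-∀

⊙-push : ∀ a ε M N D → push a ε M ⊙ (N , D) ≡ M ⊙ (ε * D , a * D + N)
⊙-push a ε ((p' , q') , (p , q)) N D = cong₂ _,_ (expand a ε N D p p') (expand a ε N D q q')
  where
  expand : ∀ a ε N D x x' → (a * x + ε * x') * D + x * N ≡ x * (a * D + N) + x' * (ε * D)
  expand = ℤRing.solve-∀

conv-split : ∀ m d j k → conv m d (suc j ℕ.+ k) ≡ state m d j ⊙ tail d (suc j) k
conv-split m d j zero rewrite ℕP.+-identityʳ j =
  push-⊙ (+ a d (suc j)) (sgn (eps d (suc j))) (state m d j)
conv-split m d j (suc k) rewrite ℕP.+-suc j k =
  trans (conv-split m d (suc j) k)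
        (⊙-push (+ a d (suc j)) (sgn (eps d (suc j))) (state m d j) N D)
  where N = proj₁ (tail d (suc (suc j)) k)
        D = proj₂ (tail d (suc (suc j)) k)

IncreasingDenominators : ConvergentPair → Set
IncreasingDenominators ((_ , q') , (_ , q)) =
  ∃₂ λ m n → q' ≡ + m × q ≡ + n × m ≤ n × 1 ≤ n

denominator-step : ∀ a ε {m n} → 1 ≤ a → + 1 ℤ.≤ + a + sgn ε → m ≤ n → 1 ≤ n →
  ∃ λ k → + a * + n + sgn ε * + m ≡ + k × n ≤ k
denominator-step (suc a) pos {m} {n} _ _ _ _ =
  suc a ℕ.* n ℕ.+ m ,
  trans (cong₂ _+_ (sym (ℤP.pos-* (suc a) n)) (ℤP.*-identityˡ (+ m)))
        (sym (ℤP.pos-+ (suc a ℕ.* n) m)) ,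
  ℕP.≤-trans (ℕP.m≤n*m n (suc a)) (ℕP.m≤m+n _ m)
denominator-step (suc zero) neg _ (ℤ.+≤+ ()) _ _
denominator-step (suc (suc a)) neg {m} {n} _ _ m≤n _ =
  2+a ℕ.* n ∸ m ,
  (begin
    + 2+a * + n + -[1+ 0 ] * + m ≡⟨ cong₂ _+_ (sym (ℤP.pos-* 2+a n)) (ℤP.-1*i≡-i (+ m)) ⟩
    + (2+a ℕ.* n) - + m          ≡⟨ ℤP.m-n≡m⊖n (2+a ℕ.* n) m ⟩
    (2+a ℕ.* n) ℤ.⊖ m            ≡⟨ ℤP.⊖-≥ (ℕP.≤-trans m≤n (ℕP.m≤n*m n 2+a)) ⟩
    + (2+a ℕ.* n ∸ m)            ∎) ,
  subst (n ≤_) (sym (ℕP.+-∸-assoc n (ℕP.≤-trans m≤n (ℕP.m≤m+n n (a ℕ.* n)))))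
    (ℕP.m≤m+n n _)
  where
  open ≡-Reasoning
  2+a = suc (suc a)

push-increasing : ∀ a ε M → 1 ≤ a → + 1 ℤ.≤ + a + sgn ε →
  IncreasingDenominators M → IncreasingDenominators (push (+ a) (sgn ε) M)
push-increasing a ε ((_ , q') , (_ , q)) 1≤a 1≤a+ε (m , n , refl , refl , m≤n , 1≤n)
  with denominator-step a ε 1≤a 1≤a+ε m≤n 1≤n
... | k , eq , n≤k = n , k , refl , eq , n≤k , ℕP.≤-trans 1≤n n≤k

denominators-increasing : ∀ m d → 1 ≤ m → (∀ i → 1 ≤ i → IndexOK m d i) →
  ∀ j → IncreasingDenominators (state m d j)
denominators-increasing m d 1≤m ok zero    = 0 , m , refl , refl , z≤n , 1≤m
denominators-increasing m d 1≤m ok (suc j) with ok (suc j) (s≤s z≤n)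
... | 1≤a , 1≤a+ε , _ =
  push-increasing (a d (suc j)) (eps d (suc j)) (state m d j) 1≤a 1≤a+ε
    (denominators-increasing m d 1≤m ok j)

⊙-error≡ : ∀ A A' B B' s w N D →
  (A * D + A' * N) * (B * w + B' * s) - (A * w + A' * s) * (B * D + B' * N)
    ≡ (A * B' - A' * B) * - (N * w - s * D)
⊙-error≡ = ℤRing.solve-∀

⊙-denominator≡ : ∀ B B' s w N D →
  D * (B * w + B' * s) ≡ w * (B * D + B' * N) + - (B' * (N * w - s * D))
⊙-denominator≡ = ℤRing.solve-∀

-- The precision asked of N/D ≈ s/w absorbs the slack β∣e∣ in ∣D∣v ≤ w∣Y∣ + β∣e∣ and two factors w.
⊙-error-bound : ∀ A A' B B' s w v c N D .{{_ : ℕ.NonZero v}} → B * + w + B' * s ≡ + v →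
  let e = N * + w - s * D; Y = B * D + B' * N
      δ = ∣ A * B' - A' * B ∣; β = ∣ B' ∣ in
  suc (w ℕ.* (w ℕ.* (suc c ℕ.* δ) ℕ.+ β)) ℕ.* ∣ e ∣ ℕ.< ∣ D ∣ ℕ.* w →
  suc c ℕ.* ∣ (A * D + A' * N) * + v - (A * + w + A' * s) * Y ∣ ℕ.< ∣ Y ∣ ℕ.* v
⊙-error-bound A A' B B' s w v c N D v≡ precise = begin-strict
    suc c ℕ.* ∣ X * + v - u * Y ∣ ≡⟨ cong (suc c ℕ.*_) error≡ ⟩
    Z                              <⟨ Z<∣Y∣ ⟩
    ∣ Y ∣                          ≤⟨ ℕP.m≤m*n ∣ Y ∣ v ⟩
    ∣ Y ∣ ℕ.* v                    ∎
  where
  open ℕP.≤-Reasoning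
  e = N * + w - s * D
  X = A * D + A' * N
  Y = B * D + B' * N
  u = A * + w + A' * s
  δ = ∣ A * B' - A' * B ∣
  β = ∣ B' ∣
  E = ∣ e ∣
  Z = suc c ℕ.* (δ ℕ.* E)

  error≡ : ∣ X * + v - u * Y ∣ ≡ δ ℕ.* E
  error≡ = begin-equality
    ∣ X * + v - u * Y ∣                      ≡⟨ cong (λ t → ∣ X * t - u * Y ∣) (sym v≡) ⟩
    ∣ X * (B * + w + B' * s) - u * Y ∣       ≡⟨ cong ∣_∣ (⊙-error≡ A A' B B' s (+ w) N D) ⟩
    ∣ (A * B' - A' * B) * - e ∣              ≡⟨ ℤP.∣i*j∣≡∣i∣*∣j∣ (A * B' - A' * B) (- e) ⟩
    δ ℕ.* ∣ - e ∣                           ≡⟨ cong (δ ℕ.*_) (ℤP.∣-i∣≡∣i∣ e) ⟩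
    δ ℕ.* E                                 ∎

  ∣D∣v≤ : ∣ D ∣ ℕ.* v ≤ w ℕ.* ∣ Y ∣ ℕ.+ β ℕ.* E
  ∣D∣v≤ = begin
    ∣ D ∣ ℕ.* v                    ≡⟨ sym (ℤP.∣i*j∣≡∣i∣*∣j∣ D (+ v)) ⟩
    ∣ D * + v ∣                    ≡⟨ cong (λ t → ∣ D * t ∣) (sym v≡) ⟩
    ∣ D * (B * + w + B' * s) ∣     ≡⟨ cong ∣_∣ (⊙-denominator≡ B B' s (+ w) N D) ⟩
    ∣ + w * Y + - (B' * e) ∣       ≤⟨ ℤP.∣i+j∣≤∣i∣+∣j∣ (+ w * Y) (- (B' * e)) ⟩
    ∣ + w * Y ∣ ℕ.+ ∣ - (B' * e) ∣ ≡⟨ cong₂ ℕ._+_ (ℤP.∣i*j∣≡∣i∣*∣j∣ (+ w) Y)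
                                       (trans (ℤP.∣-i∣≡∣i∣ (B' * e)) (ℤP.∣i*j∣≡∣i∣*∣j∣ B' e)) ⟩
    w ℕ.* ∣ Y ∣ ℕ.+ β ℕ.* E        ∎

  regroup : ∀ c δ β w E → suc (w ℕ.* (w ℕ.* (suc c ℕ.* δ) ℕ.+ β)) ℕ.* E
    ≡ w ℕ.* (w ℕ.* (suc c ℕ.* (δ ℕ.* E)) ℕ.+ β ℕ.* E) ℕ.+ E
  regroup = ℕRing.solve-∀

  reassoc : ∀ x w v → x ℕ.* w ℕ.* v ≡ w ℕ.* (x ℕ.* v)
  reassoc = ℕRing.solve-∀

  w[wZ+βE]<w[w∣Y∣+βE] : w ℕ.* (w ℕ.* Z ℕ.+ β ℕ.* E) ℕ.< w ℕ.* (w ℕ.* ∣ Y ∣ ℕ.+ β ℕ.* E)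
  w[wZ+βE]<w[w∣Y∣+βE] = begin-strict
    w ℕ.* (w ℕ.* Z ℕ.+ β ℕ.* E)         ≤⟨ ℕP.m≤m+n _ E ⟩
    w ℕ.* (w ℕ.* Z ℕ.+ β ℕ.* E) ℕ.+ E   ≡⟨ sym (regroup c δ β w E) ⟩
    _                                   <⟨ precise ⟩
    ∣ D ∣ ℕ.* w                         ≤⟨ ℕP.m≤m*n _ v ⟩
    ∣ D ∣ ℕ.* w ℕ.* v                   ≡⟨ reassoc ∣ D ∣ w v ⟩
    w ℕ.* (∣ D ∣ ℕ.* v)                 ≤⟨ ℕP.*-monoʳ-≤ w ∣D∣v≤ ⟩
    w ℕ.* (w ℕ.* ∣ Y ∣ ℕ.+ β ℕ.* E)     ∎

  Z<∣Y∣ : Z ℕ.< ∣ Y ∣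
  Z<∣Y∣ = ℕP.*-cancelˡ-< w _ _
            (ℕP.+-cancelʳ-< (β ℕ.* E) _ _ (ℕP.*-cancelˡ-< w _ _ w[wZ+βE]<w[w∣Y∣+βE]))

⊙-tendsTo : ∀ M g s w v .{{_ : ℕ.NonZero v}} → proj₂ (M ⊙ (s , + w)) ≡ + v →
  TendsTo g s w → TendsTo (λ k → M ⊙ g k) (proj₁ (M ⊙ (s , + w))) v
⊙-tendsTo ((A' , B') , (A , B)) g s w v v≡ g→s/w c
  with g→s/w (w ℕ.* (w ℕ.* (suc c ℕ.* ∣ A * B' - A' * B ∣) ℕ.+ ∣ B' ∣))
... | K , close = K , λ k K≤k →
  ⊙-error-bound A A' B B' s w v c (proj₁ (g k)) (proj₂ (g k)) v≡ (close k K≤k)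

tendsTo-cong : ∀ {f g u v} → (∀ k → f k ≡ g k) → TendsTo f u v → TendsTo g u v
tendsTo-cong {u = u} {v} f≗g f→u/v c with f→u/v c
... | K , close = K , λ k K≤k →
  subst (λ t → suc c ℕ.* ∣ proj₁ t * + v - u * proj₂ t ∣ ℕ.< ∣ proj₂ t ∣ ℕ.* v)
        (f≗g k) (close k K≤k)

tendsTo-shift : ∀ {f u v} j → TendsTo (λ k → f (j ℕ.+ k)) u v → TendsTo f u v
tendsTo-shift {f} {u} {v} j f→u/v c with f→u/v c
... | K , close = j ℕ.+ K , λ k j+K≤k →
  let j≤k = ℕP.≤-trans (ℕP.m≤m+n j K) j+K≤k
      K≤k∸j = subst (_≤ k ∸ j) (ℕP.m+n∸m≡n j K) (ℕP.∸-monoˡ-≤ j j+K≤k)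
  in subst (λ t → suc c ℕ.* ∣ proj₁ (f t) * + v - u * proj₂ (f t) ∣ ℕ.< ∣ proj₂ (f t) ∣ ℕ.* v)
           (ℕP.m+[n∸m]≡n j≤k) (close (k ∸ j) K≤k∸j)

rescale≡ : ∀ N D u v u' v' → u * v' ≡ u' * v → (N * v' - u' * D) * v ≡ (N * v - u * D) * v'
rescale≡ N D u v u' v' u/v≃u'/v' = begin
  (N * v' - u' * D) * v    ≡⟨ expand N D u' v' v ⟩
  N * v' * v - u' * v * D  ≡⟨ cong (λ t → N * v' * v - t * D) (sym u/v≃u'/v') ⟩
  N * v' * v - u * v' * D  ≡⟨ collect N D u v v' ⟩
  (N * v - u * D) * v'     ∎
  where
  open ≡-Reasoning
  expand : ∀ N D u v w → (N * v - u * D) * w ≡ N * v * w - u * w * D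
  expand = ℤRing.solve-∀
  collect : ∀ N D u v w → N * w * v - u * w * D ≡ (N * v - u * D) * w
  collect = ℤRing.solve-∀

tendsTo-resp-≃ : ∀ {f u v u' v'} .{{_ : ℕ.NonZero v'}} → u * + v' ≡ u' * + v →
  TendsTo f u v → TendsTo f u' v'
tendsTo-resp-≃ {f} {u} {v} {u'} {v'} u/v≃u'/v' f→u/v c with f→u/v c
... | K , close = K , λ k K≤k → rescale (proj₁ (f k)) (proj₂ (f k)) (close k K≤k)
  where
  rescale : ∀ N D → suc c ℕ.* ∣ N * + v - u * D ∣ ℕ.< ∣ D ∣ ℕ.* v →
    suc c ℕ.* ∣ N * + v' - u' * D ∣ ℕ.< ∣ D ∣ ℕ.* v'
  rescale N D close = ℕP.*-cancelˡ-< v _ _ (begin-strict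
      v ℕ.* (suc c ℕ.* L')       ≡⟨ swap v (suc c) L' ⟩
      suc c ℕ.* (L' ℕ.* v)       ≡⟨ cong (suc c ℕ.*_) L'v≡Lv' ⟩
      suc c ℕ.* (L ℕ.* v')       ≡⟨ ℕP.*-assoc (suc c) L v' ⟨
      suc c ℕ.* L ℕ.* v'         <⟨ ℕP.*-monoˡ-< v' close ⟩
      ∣ D ∣ ℕ.* v ℕ.* v'         ≡⟨ swap' ∣ D ∣ v v' ⟩
      v ℕ.* (∣ D ∣ ℕ.* v')       ∎)
    where
    open ℕP.≤-Reasoning
    L  = ∣ N * + v - u * D ∣
    L' = ∣ N * + v' - u' * D ∣
    L'v≡Lv' : L' ℕ.* v ≡ L ℕ.* v'
    L'v≡Lv' = trans (sym (ℤP.∣i*j∣≡∣i∣*∣j∣ (N * + v' - u' * D) (+ v)))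
              (trans (cong ∣_∣ (rescale≡ N D u (+ v) u' (+ v') u/v≃u'/v'))
                     (ℤP.∣i*j∣≡∣i∣*∣j∣ (N * + v - u * D) (+ v')))
    swap : ∀ x y z → x ℕ.* (y ℕ.* z) ≡ y ℕ.* (z ℕ.* x)
    swap = ℕRing.solve-∀
    swap' : ∀ x y z → x ℕ.* y ℕ.* z ≡ y ℕ.* (x ℕ.* z)
    swap' = ℕRing.solve-∀

tendsTo-toℚ : ∀ {f u} k → TendsTo f u (suc k) → ∃ λ r → TendsToℚ f r
tendsTo-toℚ {f} {u} k f→u/v with fraction-toℚ u (+ suc k) (λ ())
... | r , u/v≃r = r , tendsTo-resp-≃ {f} {u} {suc k} {↥ r} {ℚ.denominatorℕ r} u/v≃r f→u/v

half⇒sgn : ∀ {s} → Half s → ∃ λ ε → sgn ε ≡ s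
half⇒sgn half+ = pos , refl
half⇒sgn half- = neg , refl

1≤2+sgn : ∀ ε → + 1 ℤ.≤ + 2 + sgn ε
1≤2+sgn pos = ℤ.+≤+ (s≤s z≤n)
1≤2+sgn neg = ℤ.+≤+ (s≤s z≤n)

convergents-tendsToℚ : ∀ m d j {s} → 1 ≤ m → (∀ i → 1 ≤ i → IndexOK m d i) →
  Half s → TendsTo (tail d (suc j)) s 2 → ∃ λ r → TendsToℚ (conv m d) r
convergents-tendsToℚ m d j 1≤m ok half tail→s/2 with half⇒sgn half
... | ε , refl
  with push-increasing 2 ε (state m d j) (s≤s z≤n) (1≤2+sgn ε)
         (denominators-increasing m d 1≤m ok j)
... | _ , suc k , _ , v≡ , _ , _ = tendsTo-toℚ {conv m d} {u} k
  (tendsTo-shift {conv m d} {u} (suc j)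
    (tendsTo-cong {u = u} (λ i → sym (conv-split m d j i))
      (⊙-tendsTo M (tail d (suc j)) (sgn ε) 2 (suc k)
        (trans (sym (cong proj₂ (push-⊙ (+ 2) (sgn ε) M))) v≡) tail→s/2)))
  where
  M = state m d j
  u = proj₁ (M ⊙ (sgn ε , + 2))

mainTheorem10 : (p l : ℕ) → Prime p →
    ((d : Digits) (n : ℕ) → MaxPlusFin p l d n →
      Q (p ^ l) d n ≢ + 0 →
      ((r : ℚ) → EqualsℚF (conv (p ^ l) d n) r → InX p l r) →
      (∃ λ i → ∃ λ s → 1 ≤ i × i ≤ n × Half s ×
         (let (N , D) = tail d i (n ∸ i) in (+ 2) * N ≡ s * D)) →
      ∃ λ r → EqualsℚF (conv (p ^ l) d n) r × InX p l r) ×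
    ((d : Digits) → MaxPlusInf p l d →
      Cauchy (conv (p ^ l) d) →
      ((r : ℚ) → TendsToℚ (conv (p ^ l) d) r → InX p l r) →
      (∃ λ i → ∃ λ s → 1 ≤ i × Half s × TendsTo (tail d i) s 2) →
      ∃ λ r → TendsToℚ (conv (p ^ l) d) r × InX p l r)
mainTheorem10 p l p-prime =
  (λ d n _ q≢0 rational⇒InX _ →
    let (r , value≃r) = fraction-toℚ (P (p ^ l) d n) (Q (p ^ l) d n) q≢0
    in r , value≃r , rational⇒InX r value≃r) ,
  λ { d ((_ , ok , _) , _) _ rational⇒InX (suc j , _ , _ , half , tail→s/2) →
    let (r , conv→r) = convergents-tendsToℚ (p ^ l) d j 1≤p^l ok half tail→s/2
    in r , conv→r , rational⇒InX r conv→r }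
  where
  1≤p^l : 1 ≤ p ^ l
  1≤p^l = ℕ.>-nonZero⁻¹ (p ^ l) ⦃ ℕP.m^n≢0 p l ⦃ prime⇒nonZero p-prime ⦄ ⦄
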